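{- Assume $G$ satisfies the Plausibility Assumption. Suppose $H$ is a $\tau$-subgraph of the form $H=H_1\cup\cdots\cup H_t$, where each $H_j$ is small and $R(H_1\cup\cdots\cup H_j)\le\zeta\cdot\mathrm{SMALL}$ for all $1\le j\le t$. Then $H$ is small.
   Context: Fix integers $K\ge3$, $3\le\tau\le K$. $G$ is a bipartite factor graph between $n$ variable-vertices and constraint-vertices, each constraint-vertex having between $\tau-1$ and $K$ neighbours. A subgraph is an edge-induced subgraph $H=G[A]$ (possibly empty, not necessarily connected); $\mathrm{cons}(H)$ is its set of constraint-vertices, $N_H(f)$ the variables adjacent to $f$ in $H$. $H$ is a $\tau$-subgraph if $|N_H(f)|\ge\tau$ for all $f\in\mathrm{cons}(H)$; a leaf is a variable-vertex of degree $1$ in $H$. Parameters $1\le\mathrm{SMALL}\le n/2$, $0<\zeta<1$, $K\le\zeta\cdot\mathrm{SMALL}$; $H$ is small if $|\mathrm{cons}(H)|\le\mathrm{SMALL}$. For a $\tau$-subgraph $H$: credits $=$ number of leaves; debits $=\sum_{i}\max(\deg_H(i)-2,0)+\sum_{f}(|N_H(f)|-\tau)$; revenue $R(H)=$ credits $-$ debits; income $I(H)=R(H)-\zeta|\mathrm{cons}(H)|$; plausible means $I(H)\ge0$. Plausibility Assumption: every $\tau$-subgraph with at most $2\cdot\mathrm{SMALL}$ constraint-vertices is plausible. -}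

module Defs where

open import Data.Bool using (Bool; true; false; if_then_else_; _∨_)
open import Data.Nat as ℕ using (ℕ; zero; suc; _∸_; _≤ᵇ_)
open import Data.Integer as ℤ using (ℤ; +_)
open import Data.Rational as ℚ using (ℚ; _/_)
open import Data.Fin using (Fin; toℕ)
open import Data.Product using (_×_)
open import Relation.Binary.PropositionalEquality using (_≡_)

count : ∀ {k} → (Fin k → Bool) → ℕ
count {zero} p = 0
count {suc k} p = (if p Data.Fin.zero then 1 else 0) ℕ.+ count (λ x → p (Data.Fin.suc x))

sumFin : ∀ {k} → (Fin k → ℕ) → ℕ
sumFin {zero} g = 0
sumFin {suc k} g = g Data.Fin.zero ℕ.+ sumFin (λ x → g (Data.Fin.suc x))

anyFin : ∀ {k} → (Fin k → Bool) → Bool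
anyFin {zero} p = false
anyFin {suc k} p = p Data.Fin.zero ∨ anyFin (λ x → p (Data.Fin.suc x))

-- A bipartite factor graph with n variable-vertices (Fin n) and m
-- constraint-vertices (Fin m), or an edge set of such a graph:
-- E i f ≡ true iff variable i is adjacent to constraint f.
Edges : ℕ → ℕ → Set
Edges n m = Fin n → Fin m → Bool

module _ {n m : ℕ} where

  _⊆ᴱ_ : Edges n m → Edges n m → Set
  A ⊆ᴱ G = ∀ i f → A i f ≡ true → G i f ≡ true

  nbrs : Edges n m → Fin m → ℕ
  nbrs H f = count (λ i → H i f)

  deg : Edges n m → Fin n → ℕ
  deg H i = count (λ f → H i f)

  inCons : Edges n m → Fin m → Bool
  inCons H f = anyFin (λ i → H i f)

  numCons : Edges n m → ℕ
  numCons H = count (inCons H)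

  IsTauSubgraph : ℕ → Edges n m → Set
  IsTauSubgraph τ H = ∀ f → inCons H f ≡ true → τ ℕ.≤ nbrs H f

  isLeaf : Edges n m → Fin n → Bool
  isLeaf H i = deg H i ℕ.≡ᵇ 1

  credits : Edges n m → ℕ
  credits H = count (isLeaf H)

  -- Σ_i max(deg_H(i) - 2, 0) + Σ_{f ∈ cons(H)} (|N_H(f)| - τ)
  -- (the second summands are ≥ 0 for τ-subgraphs, so truncated subtraction is exact)
  debits : ℕ → Edges n m → ℕ
  debits τ H = sumFin (λ i → deg H i ∸ 2)
         ℕ.+ sumFin (λ f → if inCons H f then nbrs H f ∸ τ else 0)

  revenue : ℕ → Edges n m → ℤ
  revenue τ H = + credits H ℤ.- + debits τ H

  income : ℕ → ℚ → Edges n m → ℚ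
  income τ ζ H = (revenue τ H / 1) ℚ.- ζ ℚ.* (+ numCons H / 1)

  Plausible : ℕ → ℚ → Edges n m → Set
  Plausible τ ζ H = ℚ.0ℚ ℚ.≤ income τ ζ H

  IsSmall : ℕ → Edges n m → Set
  IsSmall SMALL H = numCons H ℕ.≤ SMALL

  PlausibilityAssumption : ℕ → ℚ → ℕ → Edges n m → Set
  PlausibilityAssumption τ ζ SMALL G =
    ∀ (H : Edges n m) → H ⊆ᴱ G → IsTauSubgraph τ H →
      numCons H ℕ.≤ 2 ℕ.* SMALL → Plausible τ ζ H

  unionAll : ∀ {t} → (Fin t → Edges n m) → Edges n m
  unionAll Hs i f = anyFin (λ k → Hs k i f)

  -- prefix union H₁ ∪ ⋯ ∪ H_{j+1} for j : Fin t (0-indexed)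
  prefixUnion : ∀ {t} → (Fin t → Edges n m) → Fin t → Edges n m
  prefixUnion Hs j i f = anyFin (λ k → (toℕ k ≤ᵇ toℕ j) Data.Bool.∧ Hs k i f)

ConstraintDegrees : ∀ {n m} → ℕ → ℕ → Edges n m → Set
ConstraintDegrees τ K G = ∀ f → (τ ∸ 1 ℕ.≤ nbrs G f) × (nbrs G f ℕ.≤ K)

-- Write P_j for the union of the first j of the H's.  Each P_{j+1} is a τ-subgraph with
-- |cons P_{j+1}| ≤ |cons P_j| + |cons H_{j+1}|, so if P_j is small then P_{j+1} has at most
-- 2·SMALL constraints and is plausible: ζ |cons P_{j+1}| ≤ R(P_{j+1}) ≤ ζ·SMALL.  Dividing by
-- ζ > 0 shows that P_{j+1} is small again, and by induction so is H = P_t.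
module Submission where

open import Defs
open import Data.Nat using (ℕ; _≤_; _*_)
open import Data.Integer using (+_)
open import Data.Rational as ℚ using (ℚ; _/_; 0ℚ; 1ℚ)
open import Data.Fin using (Fin)

open import Data.Bool using (Bool; true; false; _∧_; _∨_; T; if_then_else_)
open import Data.Bool.Properties using (T-≡; ∨-zeroʳ)
open import Data.Fin using (toℕ; fromℕ<)
open import Data.Fin.Properties using (toℕ-injective; toℕ-fromℕ<; toℕ<n)
open import Data.Integer.Properties as ℤ using ()
open import Data.Nat as ℕ using (zero; suc; _<_; _+_; _≤ᵇ_; _<ᵇ_; z≤n; s≤s)
open import Data.Nat.Coprimality using (gcd≡1⇒coprime)
open import Data.Nat.GCD using (gcd-zeroʳ)
open import Data.Nat.Properties as ℕ using ()
open import Data.Product using (∃; _×_; _,_)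
open import Data.Rational.Properties as ℚ using ()
open import Data.Sum using (_⊎_; inj₁; inj₂)
open import Function.Bundles using (Equivalence)
open import Relation.Binary.PropositionalEquality

+/1≡mkℚ : ∀ a → + a / 1 ≡ ℚ.mkℚ (+ a) 0 (gcd≡1⇒coprime (gcd-zeroʳ a))
+/1≡mkℚ a = ℚ.normalize-coprime (gcd≡1⇒coprime (gcd-zeroʳ a))

+/1-cancel-≤ : ∀ a b → (+ a / 1) ℚ.≤ (+ b / 1) → a ≤ b
+/1-cancel-≤ a b a≤b rewrite +/1≡mkℚ a | +/1≡mkℚ b with a≤b
... | ℚ.*≤* a*1≤b*1 rewrite ℤ.*-identityʳ (+ a) | ℤ.*-identityʳ (+ b) = ℤ.drop‿+≤+ a*1≤b*1

0≤q-p⇒p≤q : ∀ p q → 0ℚ ℚ.≤ q ℚ.- p → p ℚ.≤ q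
0≤q-p⇒p≤q p q 0≤q-p = begin
  p                  ≡⟨ ℚ.+-identityˡ p ⟨
  0ℚ ℚ.+ p           ≤⟨ ℚ.+-monoˡ-≤ p 0≤q-p ⟩
  (q ℚ.- p) ℚ.+ p    ≡⟨ ℚ.+-assoc q (ℚ.- p) p ⟩
  q ℚ.+ (ℚ.- p ℚ.+ p) ≡⟨ cong (q ℚ.+_) (ℚ.+-inverseˡ p) ⟩
  q ℚ.+ 0ℚ           ≡⟨ ℚ.+-identityʳ q ⟩
  q                  ∎
  where open ℚ.≤-Reasoning

plausible⇒small : ∀ {n m} {τ SMALL} {ζ} {H : Edges n m} → 0ℚ ℚ.< ζ →
                  Plausible τ ζ H → (revenue τ H / 1) ℚ.≤ ζ ℚ.* (+ SMALL / 1) →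
                  IsSmall SMALL H
plausible⇒small {τ = τ} {SMALL} {ζ} {H} 0<ζ plausible lowRevenue =
  +/1-cancel-≤ (numCons H) SMALL
    (ℚ.*-cancelˡ-≤-pos ζ {{ℚ.positive 0<ζ}}
      (ℚ.≤-trans (0≤q-p⇒p≤q _ (revenue τ H / 1) plausible) lowRevenue))

anyFin⇒∃ : ∀ {k} (p : Fin k → Bool) → anyFin p ≡ true → ∃ λ x → p x ≡ true
anyFin⇒∃ {suc k} p any with p Fin.zero in p0
... | true  = Fin.zero , p0
... | false with anyFin⇒∃ (λ x → p (Fin.suc x)) any
... | x , px = Fin.suc x , px

∃⇒anyFin : ∀ {k} (p : Fin k → Bool) (x : Fin k) → p x ≡ true → anyFin p ≡ true
∃⇒anyFin p Fin.zero    px rewrite px = refl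
∃⇒anyFin p (Fin.suc x) px with p Fin.zero
... | true  = refl
... | false = ∃⇒anyFin (λ y → p (Fin.suc y)) x px

anyFin-none : ∀ {k} (p : Fin k → Bool) → (∀ x → p x ≡ false) → anyFin p ≡ false
anyFin-none {zero}  p none = refl
anyFin-none {suc k} p none rewrite none Fin.zero =
  anyFin-none (λ x → p (Fin.suc x)) (λ x → none (Fin.suc x))

T⇒≡true : ∀ {b} → T b → b ≡ true
T⇒≡true = Equivalence.to T-≡

≡true⇒T : ∀ {b} → b ≡ true → T b
≡true⇒T = Equivalence.from T-≡

anyFin-∧⇒∃ : ∀ {k} (b p : Fin k → Bool) → anyFin (λ x → b x ∧ p x) ≡ true →
             ∃ λ x → b x ≡ true × p x ≡ true
anyFin-∧⇒∃ b p any with x , bx∧px ← anyFin⇒∃ _ any | b x in bx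
... | true = x , bx , bx∧px

∃⇒anyFin-∧ : ∀ {k} (b p : Fin k → Bool) (x : Fin k) → b x ≡ true → p x ≡ true →
             anyFin (λ x → b x ∧ p x) ≡ true
∃⇒anyFin-∧ b p x bx px = ∃⇒anyFin _ x (cong₂ _∧_ bx px)

count-none : ∀ {k} (p : Fin k → Bool) → (∀ x → p x ≡ false) → count p ≡ 0
count-none {zero}  p none = refl
count-none {suc k} p none rewrite none Fin.zero =
  count-none (λ x → p (Fin.suc x)) (λ x → none (Fin.suc x))

count-mono : ∀ {k} (p q : Fin k → Bool) → (∀ x → p x ≡ true → q x ≡ true) → count p ≤ count q
count-mono {zero}  p q p⇒q = z≤n
count-mono {suc k} p q p⇒q with p Fin.zero in p0 | q Fin.zero in q0
... | true  | true  = s≤s (count-mono _ _ (λ x → p⇒q (Fin.suc x)))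
... | true  | false with () ← trans (sym (p⇒q Fin.zero p0)) q0
... | false | true  = ℕ.m≤n⇒m≤1+n (count-mono _ _ (λ x → p⇒q (Fin.suc x)))
... | false | false = count-mono _ _ (λ x → p⇒q (Fin.suc x))

indicator : Bool → ℕ
indicator b = if b then 1 else 0

indicator-+-⊆-∪ : ∀ {b c d} {a x y} → (b ≡ true → c ≡ true ⊎ d ≡ true) → a ≤ x + y →
                  indicator b + a ≤ (indicator c + x) + (indicator d + y)
indicator-+-⊆-∪ {false} {c} {d} {x = x} _ a≤x+y =
  ℕ.≤-trans a≤x+y (ℕ.+-mono-≤ (ℕ.m≤n+m x (indicator c)) (ℕ.m≤n+m _ (indicator d)))
indicator-+-⊆-∪ {true} {true} {d} {x = x} _ a≤x+y =
  s≤s (ℕ.≤-trans a≤x+y (ℕ.+-monoʳ-≤ x (ℕ.m≤n+m _ (indicator d))))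
indicator-+-⊆-∪ {true} {false} {true} {x = x} {y} _ a≤x+y =
  ℕ.≤-trans (s≤s a≤x+y) (ℕ.≤-reflexive (sym (ℕ.+-suc x y)))
indicator-+-⊆-∪ {true} {false} {false} b⇒c∨d _ with b⇒c∨d refl
... | inj₁ ()
... | inj₂ ()

count-⊆-∪ : ∀ {k} (p q r : Fin k → Bool) → (∀ x → p x ≡ true → q x ≡ true ⊎ r x ≡ true) →
            count p ≤ count q + count r
count-⊆-∪ {zero}  p q r p⇒q∨r = z≤n
count-⊆-∪ {suc k} p q r p⇒q∨r =
  indicator-+-⊆-∪ (p⇒q∨r Fin.zero) (count-⊆-∪ _ _ _ (λ x → p⇒q∨r (Fin.suc x)))

module _ {n m : ℕ} where

  _∪ᴱ_ : Edges n m → Edges n m → Edges n m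
  (A ∪ᴱ B) i f = A i f ∨ B i f

  numCons-edgeless : (H : Edges n m) → (∀ i f → H i f ≡ false) → numCons H ≡ 0
  numCons-edgeless H edgeless = count-none _ (λ f → anyFin-none _ (λ i → edgeless i f))

  numCons-mono : {A B : Edges n m} → A ⊆ᴱ B → numCons A ≤ numCons B
  numCons-mono {A} {B} A⊆B = count-mono _ _ A-cons⇒B-cons
    where
    A-cons⇒B-cons : ∀ f → inCons A f ≡ true → inCons B f ≡ true
    A-cons⇒B-cons f f∈A with i , Aif ← anyFin⇒∃ _ f∈A = ∃⇒anyFin _ i (A⊆B i f Aif)

  numCons-∪ : (A B : Edges n m) → numCons (A ∪ᴱ B) ≤ numCons A + numCons B
  numCons-∪ A B = count-⊆-∪ _ _ _ ∪-cons⇒A-cons∨B-cons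
    where
    ∪-cons⇒A-cons∨B-cons : ∀ f → inCons (A ∪ᴱ B) f ≡ true → inCons A f ≡ true ⊎ inCons B f ≡ true
    ∪-cons⇒A-cons∨B-cons f f∈A∪B with i , Aif∨Bif ← anyFin⇒∃ _ f∈A∪B | A i f in Aif
    ... | true  = inj₁ (∃⇒anyFin _ i Aif)
    ... | false = inj₂ (∃⇒anyFin _ i Aif∨Bif)

  ∪ᴱ-introˡ : ∀ A B {i f} → A i f ≡ true → (A ∪ᴱ B) i f ≡ true
  ∪ᴱ-introˡ A B Aif rewrite Aif = refl

  ∪ᴱ-introʳ : ∀ A B {i f} → B i f ≡ true → (A ∪ᴱ B) i f ≡ true
  ∪ᴱ-introʳ A B {i} {f} Bif rewrite Bif = ∨-zeroʳ (A i f)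

module _ {n m t : ℕ} (Hs : Fin t → Edges n m) where

  -- The union of the first j graphs.  Unlike prefixUnion it is indexed by ℕ, so that it
  -- also covers the empty prefix (j = 0) and the whole union (j = t).
  firstUnion : ℕ → Edges n m
  firstUnion j i f = anyFin (λ k → (toℕ k <ᵇ j) ∧ Hs k i f)

  firstUnion-intro : ∀ {j i f} k → toℕ k < j → Hs k i f ≡ true → firstUnion j i f ≡ true
  firstUnion-intro {j} {i} {f} k k<j Hskif =
    ∃⇒anyFin-∧ (λ k → toℕ k <ᵇ j) (λ k → Hs k i f) k (T⇒≡true (ℕ.<⇒<ᵇ k<j)) Hskif

  firstUnion-elim : ∀ {j i f} → firstUnion j i f ≡ true → ∃ λ k → toℕ k < j × Hs k i f ≡ true
  firstUnion-elim {j} {i} {f} edge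
    with k , k<ᵇj , Hskif ← anyFin-∧⇒∃ (λ k → toℕ k <ᵇ j) (λ k → Hs k i f) edge =
    k , ℕ.<ᵇ⇒< (toℕ k) j (≡true⇒T k<ᵇj) , Hskif

  prefixUnion-intro : ∀ {j i f} k → toℕ k ≤ toℕ j → Hs k i f ≡ true →
                      prefixUnion Hs j i f ≡ true
  prefixUnion-intro {j} {i} {f} k k≤j Hskif =
    ∃⇒anyFin-∧ (λ k → toℕ k ≤ᵇ toℕ j) (λ k → Hs k i f) k (T⇒≡true (ℕ.≤⇒≤ᵇ k≤j)) Hskif

  prefixUnion-elim : ∀ {j i f} → prefixUnion Hs j i f ≡ true →
                     ∃ λ k → toℕ k ≤ toℕ j × Hs k i f ≡ true
  prefixUnion-elim {j} {i} {f} edge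
    with k , k≤ᵇj , Hskif ← anyFin-∧⇒∃ (λ k → toℕ k ≤ᵇ toℕ j) (λ k → Hs k i f) edge =
    k , ℕ.≤ᵇ⇒≤ (toℕ k) (toℕ j) (≡true⇒T k≤ᵇj) , Hskif

  firstUnion-zero-edgeless : ∀ i f → firstUnion 0 i f ≡ false
  firstUnion-zero-edgeless i f = anyFin-none (λ k → (toℕ k <ᵇ 0) ∧ Hs k i f) (λ _ → refl)

  unionAll-⊆-firstUnion : unionAll Hs ⊆ᴱ firstUnion t
  unionAll-⊆-firstUnion i f edge with k , Hskif ← anyFin⇒∃ (λ k → Hs k i f) edge =
    firstUnion-intro k (toℕ<n k) Hskif

  firstUnion-suc-⊆-prefixUnion : ∀ j → firstUnion (suc (toℕ j)) ⊆ᴱ prefixUnion Hs j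
  firstUnion-suc-⊆-prefixUnion j i f edge with k , k<1+j , Hskif ← firstUnion-elim edge =
    prefixUnion-intro k (ℕ.m<1+n⇒m≤n k<1+j) Hskif

  prefixUnion-⊆-firstUnion-∪ : ∀ j → prefixUnion Hs j ⊆ᴱ (firstUnion (toℕ j) ∪ᴱ Hs j)
  prefixUnion-⊆-firstUnion-∪ j i f edge with k , k≤j , Hskif ← prefixUnion-elim edge
                                          with ℕ.m≤n⇒m<n∨m≡n k≤j
  ... | inj₁ k<j = ∪ᴱ-introˡ (firstUnion (toℕ j)) (Hs j) (firstUnion-intro k k<j Hskif)
  ... | inj₂ k≡j = ∪ᴱ-introʳ (firstUnion (toℕ j)) (Hs j)
                     (subst (λ k → Hs k i f ≡ true) (toℕ-injective k≡j) Hskif)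

  prefixUnion-⊆ : ∀ {G} → (∀ k → Hs k ⊆ᴱ G) → ∀ j → prefixUnion Hs j ⊆ᴱ G
  prefixUnion-⊆ Hs⊆G j i f edge with k , _ , Hskif ← prefixUnion-elim edge = Hs⊆G k i f Hskif

module _ {n m t τ SMALL : ℕ} {ζ : ℚ} {G : Edges n m} (Hs : Fin t → Edges n m)
         (0<ζ : 0ℚ ℚ.< ζ) (plausibility : PlausibilityAssumption τ ζ SMALL G)
         (Hs⊆G : ∀ k → Hs k ⊆ᴱ G) (Hs-small : ∀ k → IsSmall SMALL (Hs k))
         (prefix-τ : ∀ k → IsTauSubgraph τ (prefixUnion Hs k))
         (prefix-revenue : ∀ k → (revenue τ (prefixUnion Hs k) / 1) ℚ.≤ ζ ℚ.* (+ SMALL / 1))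
         where

  prefixUnion-small : ∀ k → IsSmall SMALL (firstUnion Hs (toℕ k)) → IsSmall SMALL (prefixUnion Hs k)
  prefixUnion-small k before-small =
    plausible⇒small {τ = τ} {H = prefixUnion Hs k} 0<ζ
      (plausibility _ (prefixUnion-⊆ Hs Hs⊆G k) (prefix-τ k) at-most-2·SMALL)
      (prefix-revenue k)
    where
    open ℕ.≤-Reasoning
    at-most-2·SMALL : numCons (prefixUnion Hs k) ≤ 2 * SMALL
    at-most-2·SMALL = begin
      numCons (prefixUnion Hs k)                         ≤⟨ numCons-mono (prefixUnion-⊆-firstUnion-∪ Hs k) ⟩
      numCons (firstUnion Hs (toℕ k) ∪ᴱ Hs k)            ≤⟨ numCons-∪ (firstUnion Hs (toℕ k)) (Hs k) ⟩
      numCons (firstUnion Hs (toℕ k)) + numCons (Hs k)   ≤⟨ ℕ.+-mono-≤ before-small (Hs-small k) ⟩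
      SMALL + SMALL                                      ≡⟨ cong (λ s → SMALL + s) (ℕ.+-identityʳ SMALL) ⟨
      2 * SMALL                                          ∎

  firstUnion-small : ∀ j → j ≤ t → IsSmall SMALL (firstUnion Hs j)
  firstUnion-small zero    _   =
    ℕ.≤-trans (ℕ.≤-reflexive (numCons-edgeless _ (firstUnion-zero-edgeless Hs))) z≤n
  firstUnion-small (suc j) j<t with k ← fromℕ< j<t | refl ← toℕ-fromℕ< j<t =
    ℕ.≤-trans (numCons-mono (firstUnion-suc-⊆-prefixUnion Hs k))
              (prefixUnion-small k (firstUnion-small (toℕ k) (ℕ.<⇒≤ j<t)))

lemma5p8 : (K τ n m SMALL : ℕ) (ζ : ℚ) (G : Edges n m) →
    3 ≤ K → 3 ≤ τ → τ ≤ K →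
    ConstraintDegrees τ K G →
    1 ≤ SMALL → 2 * SMALL ≤ n →
    0ℚ ℚ.< ζ → ζ ℚ.< 1ℚ →
    (+ K / 1) ℚ.≤ ζ ℚ.* (+ SMALL / 1) →
    PlausibilityAssumption τ ζ SMALL G →
    (t : ℕ) (Hs : Fin t → Edges n m) →
    (∀ j → Hs j ⊆ᴱ G) →
    IsTauSubgraph τ (unionAll Hs) →
    (∀ j → IsSmall SMALL (Hs j)) →
    (∀ j → IsTauSubgraph τ (prefixUnion Hs j)) →
    (∀ j → (revenue τ (prefixUnion Hs j) / 1) ℚ.≤ ζ ℚ.* (+ SMALL / 1)) →
    IsSmall SMALL (unionAll Hs)
lemma5p8 K τ n m SMALL ζ G _ _ _ _ _ _ 0<ζ _ _ plausibility t Hs Hs⊆G _ Hs-small prefix-τ prefix-revenue =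
  ℕ.≤-trans (numCons-mono (unionAll-⊆-firstUnion Hs))
            (firstUnion-small Hs 0<ζ plausibility Hs⊆G Hs-small prefix-τ prefix-revenue t ℕ.≤-refl)
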